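{- Let ${\sf A}$ be an animal with $|{\sf V}({\sf A})|=N$. Then for any $\lambda>0$, \[ C({\sf A};\lambda)\le\max\{1;\,2N/\lambda\}. \]
   Context: ${\sf G}=({\sf V},{\sf E})$ is a simple graph; an animal is a finite connected subgraph ${\sf A}$ of ${\sf G}$ with vertex set ${\sf V}({\sf A})$. For $x,y\in{\sf V}({\sf A})$, $\rho_{\sf A}(x,y)$ is the length of a shortest path from $x$ to $y$ using only vertices and edges of ${\sf A}$. Given $\lambda>0$, a set ${\sf B}\subset{\sf V}({\sf A})$ is $\lambda$-admissible in ${\sf A}$ if $\rho_{\sf A}(x,y)\ge\lambda$ for all distinct $x,y\in{\sf B}$, and the $\lambda$-capacity of ${\sf A}$ is $C({\sf A};\lambda)=\max\{|{\sf B}|:{\sf B}\text{ is }\lambda\text{ -admissible in }{\sf A}\}$.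
   Formalization: The parameter λ ranges over the positive rationals. -}

module Defs where

open import Data.Nat using (ℕ; zero; suc; _*_) renaming (_≤_ to _≤ℕ_)
open import Data.Fin using (Fin)
open import Data.Fin.Subset using (Subset; _∈_; ∣_∣)
open import Data.Integer using (+_)
open import Data.Rational using (ℚ; _/_; _≤_; _÷_; _⊔_; Positive; 1ℚ)
open import Data.Rational.Properties using (pos⇒nonZero)
open import Data.Product using (Σ; ∃; _×_)
open import Relation.Binary.PropositionalEquality using (_≡_; _≢_)
open import Relation.Nullary using (¬_)

-- An animal A (finite connected subgraph of G) is, for all purposes of the
-- statement, determined by its own vertex set (of size N, identified with
-- Fin N) and its own edges; distances ρ_A use only vertices/edges of A.
record SimpleGraph (N : ℕ) : Set₁ where
  field
    Adj   : Fin N → Fin N → Set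
    sym   : ∀ {x y} → Adj x y → Adj y x
    irrefl : ∀ {x} → ¬ Adj x x

ℕtoℚ : ℕ → ℚ
ℕtoℚ n = + n / 1

module _ {N : ℕ} (A : SimpleGraph N) where
  open SimpleGraph A

  data Walk : Fin N → Fin N → ℕ → Set where
    [] : ∀ {x} → Walk x x 0
    _∷_ : ∀ {x y z n} → Adj x y → Walk y z n → Walk x z (suc n)

  Connected : Set
  Connected = ∀ x y → ∃ λ n → Walk x y n

  IsDist : Fin N → Fin N → ℕ → Set
  IsDist x y d = Walk x y d × (∀ m → Walk x y m → d ≤ℕ m)

  Admissible : ℚ → Subset N → Set
  Admissible λ' B = ∀ x y → x ∈ B → y ∈ B → x ≢ y →
                    ∀ d → IsDist x y d → λ' ≤ ℕtoℚ d

  bound : (λ' : ℚ) → .{{Positive λ'}} → ℚ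
  bound λ' = 1ℚ ⊔ ((ℕtoℚ (2 * N) ÷ λ') {{pos⇒nonZero λ'}})

-- Choose r with 2r < λ ≤ 2(r + 1).  Every point b of B lies at distance at
-- least λ > r from another point of B, so the first r + 1 vertices of a
-- geodesic leaving b are distinct and within distance r of b.  These balls
-- around the points of B are disjoint, as a common vertex would join two points
-- of B by a walk of length at most 2r < λ; hence |B|(r + 1) ≤ N and |B|λ ≤ 2N.
-- Adjacency is not decidable, so geodesics exist only classically; this is
-- harmless because the conclusion is a decidable inequality of rationals.
module Submission where

open import Defs
open import Data.Nat using (ℕ)
open import Data.Fin.Subset using (Subset; ∣_∣)
open import Data.Rational using (ℚ; _≤_; Positive)

open import Data.Bool using (true; false)
open import Data.Empty using (⊥-elim)
open import Data.Fin as Fin using (Fin; zero; suc; toℕ; punchIn; remQuot)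
open import Data.Fin.Properties
  using (toℕ-injective; toℕ≤pred[n]; punchInᵢ≢i; suc-injective; ∀-cons; injective⇒≤; *↔×)
open import Data.Fin.Subset using (_∈_)
open import Data.Integer as ℤ using (+_)
open import Data.Integer.Properties using (+◃n≡+n; *-identityʳ)
open import Data.Nat as ℕ using (suc; z≤n; s≤s; _∸_; ⌊_/2⌋)
open import Data.Nat.Coprimality using (1-coprimeTo) renaming (sym to coprime-sym)
open import Data.Nat.Induction using (<-rec)
open import Data.Nat.Properties as ℕP using (≤-trans; ≤-reflexive; +-suc; module ≤-Reasoning)
open import Data.Product using (Σ; Σ-syntax; _×_; _,_; proj₁; proj₂)
open import Data.Rational as ℚ using (mkℚ; *≤*; 1ℚ; _÷_)
open import Data.Rational.Properties as ℚP using (pos⇒nonZero)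
open import Data.Vec using (_∷_; here; there)
open import Function using (_∘_)
open import Function.Bundles using (Injection)
open import Function.Properties.Inverse using (↔⇒↣)
open import Relation.Binary.PropositionalEquality
open import Relation.Nullary using (¬_; yes; no)
open import Relation.Nullary.Decidable using (decidable-stable; ¬¬-excluded-middle)

ℕtoℚ≡mkℚ : ∀ n → ℕtoℚ n ≡ mkℚ (+ n) 0 (coprime-sym (1-coprimeTo n))
ℕtoℚ≡mkℚ n = ℚP.normalize-coprime (coprime-sym (1-coprimeTo n))

ℕtoℚ-homo-* : ∀ m n → ℕtoℚ (m ℕ.* n) ≡ ℕtoℚ m ℚ.* ℕtoℚ n
ℕtoℚ-homo-* m n rewrite ℕtoℚ≡mkℚ m | ℕtoℚ≡mkℚ n =
  sym (cong (ℚ._/ 1) (+◃n≡+n (m ℕ.* n)))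

ℕtoℚ-mono-≤ : ∀ {m n} → m ℕ.≤ n → ℕtoℚ m ≤ ℕtoℚ n
ℕtoℚ-mono-≤ {m} {n} m≤n rewrite ℕtoℚ≡mkℚ m | ℕtoℚ≡mkℚ n =
  *≤* (subst₂ ℤ._≤_ (sym (*-identityʳ (+ m))) (sym (*-identityʳ (+ n)))
        (ℤ.+≤+ m≤n))

ℕtoℚ-nonNeg : ∀ n → ℚ.NonNegative (ℕtoℚ n)
ℕtoℚ-nonNeg n = subst ℚ.NonNegative (sym (ℕtoℚ≡mkℚ n)) _

*≤⇒≤÷ : ∀ {p q} r .{{_ : Positive r}} → p ℚ.* r ≤ q → p ≤ (q ÷ r) {{pos⇒nonZero r}}
*≤⇒≤÷ {p} {q} r pr≤q = ℚP.*-cancelʳ-≤-pos r (ℚP.≤-trans pr≤q (ℚP.≤-reflexive q≡q÷r*r))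
  where
  instance
    r-nonZero : ℚ.NonZero r
    r-nonZero = pos⇒nonZero r
  q≡q÷r*r : q ≡ (q ÷ r) ℚ.* r
  q≡q÷r*r = sym (begin
    (q ℚ.* ℚ.1/ r) ℚ.* r  ≡⟨ ℚP.*-assoc q (ℚ.1/ r) r ⟩
    q ℚ.* (ℚ.1/ r ℚ.* r)  ≡⟨ cong (q ℚ.*_) (ℚP.*-inverseˡ r) ⟩
    q ℚ.* 1ℚ              ≡⟨ ℚP.*-identityʳ q ⟩
    q                     ∎)
    where open ≡-Reasoning

leastℕ≥ : ∀ q n → q ≤ ℕtoℚ n → Σ[ d ∈ ℕ ] q ≤ ℕtoℚ d × (∀ m → q ≤ ℕtoℚ m → d ℕ.≤ m)
leastℕ≥ q ℕ.zero q≤0 = 0 , q≤0 , λ _ _ → z≤n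
leastℕ≥ q (suc n) q≤1+n with q ℚP.≤? ℕtoℚ n
... | yes q≤n = leastℕ≥ q n q≤n
... | no  q≰n = suc n , q≤1+n , λ m q≤m →
  ℕP.≰⇒> (λ m≤n → q≰n (ℚP.≤-trans q≤m (ℕtoℚ-mono-≤ m≤n)))

⌊n/2⌋+⌊n/2⌋≤n : ∀ n → ⌊ n /2⌋ ℕ.+ ⌊ n /2⌋ ℕ.≤ n
⌊n/2⌋+⌊n/2⌋≤n n =
  ≤-trans (ℕP.+-monoʳ-≤ ⌊ n /2⌋ (ℕP.⌊n/2⌋≤⌈n/2⌉ n)) (≤-reflexive (ℕP.⌊n/2⌋+⌈n/2⌉≡n n))

n≤1+⌊n/2⌋+⌊n/2⌋ : ∀ n → n ℕ.≤ suc (⌊ n /2⌋ ℕ.+ ⌊ n /2⌋)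
n≤1+⌊n/2⌋+⌊n/2⌋ 0 = z≤n
n≤1+⌊n/2⌋+⌊n/2⌋ 1 = s≤s z≤n
n≤1+⌊n/2⌋+⌊n/2⌋ (suc (suc n)) =
  s≤s (≤-trans (s≤s (n≤1+⌊n/2⌋+⌊n/2⌋ n)) (≤-reflexive (sym (+-suc (suc ⌊ n /2⌋) _))))

¬¬-Π-Fin : ∀ {n} {P : Fin n → Set} → (∀ i → ¬ ¬ P i) → ¬ ¬ (∀ i → P i)
¬¬-Π-Fin {ℕ.zero} _ k = k (λ ())
¬¬-Π-Fin {suc n} h k = h zero λ p₀ → ¬¬-Π-Fin (h ∘ suc) λ ps → k (∀-cons p₀ ps)

elements : ∀ {n} (p : Subset n) → Fin ∣ p ∣ → Fin n
elements (true  ∷ p) zero    = zero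
elements (true  ∷ p) (suc i) = suc (elements p i)
elements (false ∷ p) i       = suc (elements p i)

elements-∈ : ∀ {n} (p : Subset n) i → elements p i ∈ p
elements-∈ (true  ∷ p) zero    = here
elements-∈ (true  ∷ p) (suc i) = there (elements-∈ p i)
elements-∈ (false ∷ p) i       = there (elements-∈ p i)

elements-injective : ∀ {n} (p : Subset n) {i j} → elements p i ≡ elements p j → i ≡ j
elements-injective (true  ∷ p) {zero}  {zero}  _  = refl
elements-injective (true  ∷ p) {suc i} {suc j} eq =
  cong suc (elements-injective p (suc-injective eq))
elements-injective (false ∷ p) eq = elements-injective p (suc-injective eq)

module _ {N : ℕ} (A : SimpleGraph N) where
  open SimpleGraph A renaming (sym to Adj-sym)

  _++ᵂ_ : ∀ {x y z m n} → Walk A x y m → Walk A y z n → Walk A x z (m ℕ.+ n)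
  []      ++ᵂ w = w
  (e ∷ u) ++ᵂ w = e ∷ (u ++ᵂ w)

  reverseᵂ : ∀ {x y n} → Walk A x y n → Walk A y x n
  reverseᵂ []                = []
  reverseᵂ {n = suc n} (e ∷ w) =
    subst (Walk A _ _) (ℕP.+-comm n 1) (reverseᵂ w ++ᵂ (Adj-sym e ∷ []))

  splitAtᵂ : ∀ {x z n} i → i ℕ.≤ n → Walk A x z n →
             Σ[ v ∈ Fin N ] Walk A x v i × Walk A v z (n ∸ i)
  splitAtᵂ ℕ.zero  _         w       = _ , [] , w
  splitAtᵂ (suc i) (s≤s i≤n) (e ∷ w) with v , u , t ← splitAtᵂ i i≤n w = v , e ∷ u , t

  IsDist-unique : ∀ {x y d d′} → IsDist A x y d → IsDist A x y d′ → d ≡ d′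
  IsDist-unique (w , min) (w′ , min′) = ℕP.≤-antisym (min _ w′) (min′ _ w)

  geodesic-prefix : ∀ {x z d i} (g : IsDist A x z d) (i≤d : i ℕ.≤ d) →
                    IsDist A x (proj₁ (splitAtᵂ i i≤d (proj₁ g))) i
  geodesic-prefix {d = d} {i} (w , min) i≤d with splitAtᵂ i i≤d w
  ... | v , u , t = u , λ m u′ → ℕP.≮⇒≥ λ m<i → ℕP.<-irrefl refl (begin-strict
    d                  ≤⟨ min _ (u′ ++ᵂ t) ⟩
    m ℕ.+ (d ∸ i)      <⟨ ℕP.+-monoˡ-< (d ∸ i) m<i ⟩
    i ℕ.+ (d ∸ i)      ≡⟨ ℕP.m+[n∸m]≡n i≤d ⟩
    d                  ∎)
    where open ≤-Reasoning

  walk⇒¬¬distance : ∀ {x y n} → Walk A x y n → ¬ ¬ Σ ℕ (IsDist A x y)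
  walk⇒¬¬distance {x} {y} {n} = <-rec (λ n → Walk A x y n → ¬ ¬ Σ ℕ (IsDist A x y)) step n
    where
    step : ∀ n → (∀ {m} → m ℕ.< n → Walk A x y m → ¬ ¬ Σ ℕ (IsDist A x y)) →
           Walk A x y n → ¬ ¬ Σ ℕ (IsDist A x y)
    step n shorter w k = ¬¬-excluded-middle {A = Σ[ m ∈ ℕ ] m ℕ.< n × Walk A x y m} λ
      { (yes (m , m<n , w′)) → shorter m<n w′ k
      ; (no none) → k (n , w , λ m w′ → ℕP.≮⇒≥ λ m<n → none (m , m<n , w′)) }

  AllDistances : Set
  AllDistances = ∀ x y → Σ ℕ (IsDist A x y)

  connected⇒¬¬allDistances : Connected A → ¬ ¬ AllDistances
  connected⇒¬¬allDistances c =
    ¬¬-Π-Fin λ x → ¬¬-Π-Fin λ y → walk⇒¬¬distance (proj₂ (c x y))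

  Separated : ∀ {k} → (Fin k → Fin N) → (ℕ → Set) → Set
  Separated e P = ∀ i j → i ≢ j → ∀ m → Walk A (e i) (e j) m → P m

  separated-packing : AllDistances → ∀ {k r} (e : Fin (2 ℕ.+ k) → Fin N) →
                      Separated e (r ℕ.+ r ℕ.<_) → (2 ℕ.+ k) ℕ.* suc r ℕ.≤ N
  separated-packing dist {k} {r} e sep =
    injective⇒≤ {f = point ∘ remQuot (suc r)}
      (Injection.injective (↔⇒↣ (*↔× {2 ℕ.+ k} {suc r})) ∘ point-injective)
    where
    geodesic : ∀ i → Σ ℕ (IsDist A (e i) (e (punchIn i zero)))
    geodesic i = dist (e i) (e (punchIn i zero))

    in-range : ∀ i (j : Fin (suc r)) → toℕ j ℕ.≤ proj₁ (geodesic i)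
    in-range i j = ≤-trans (toℕ≤pred[n] j) (≤-trans (ℕP.m≤m+n r r)
      (ℕP.<⇒≤ (sep i _ (punchInᵢ≢i i zero ∘ sym) _ (proj₁ (proj₂ (geodesic i))))))

    point : Fin (2 ℕ.+ k) × Fin (suc r) → Fin N
    point (i , j) = proj₁ (splitAtᵂ (toℕ j) (in-range i j) (proj₁ (proj₂ (geodesic i))))

    point-dist : ∀ i j → IsDist A (e i) (point (i , j)) (toℕ j)
    point-dist i j = geodesic-prefix (proj₂ (geodesic i)) (in-range i j)

    point-injective : ∀ {p q} → point p ≡ point q → p ≡ q
    point-injective {i , j} {i′ , j′} eq with i Fin.≟ i′
    ... | yes refl = cong (i ,_) (toℕ-injective (IsDist-unique (point-dist i j)
          (subst (λ v → IsDist A (e i) v (toℕ j′)) (sym eq) (point-dist i j′))))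
    ... | no i≢i′ = ⊥-elim (ℕP.<⇒≱ (sep i i′ i≢i′ _ short)
          (ℕP.+-mono-≤ (toℕ≤pred[n] j) (toℕ≤pred[n] j′)))
      where
      short : Walk A (e i) (e i′) (toℕ j ℕ.+ toℕ j′)
      short = proj₁ (point-dist i j) ++ᵂ reverseᵂ
        (subst (λ v → Walk A (e i′) v (toℕ j′)) (sym eq) (proj₁ (point-dist i′ j′)))

  separated-bound : AllDistances → ∀ {k s} (e : Fin (2 ℕ.+ k) → Fin N) →
                    Separated e (s ℕ.≤_) → (2 ℕ.+ k) ℕ.* s ℕ.≤ 2 ℕ.* N
  separated-bound dist {k} {ℕ.zero} e sep = ≤-trans (≤-reflexive (ℕP.*-zeroʳ k)) z≤n
  separated-bound dist {k} {suc n} e sep = begin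
    (2 ℕ.+ k) ℕ.* suc n                           ≤⟨ ℕP.*-monoʳ-≤ (2 ℕ.+ k) 1+n≤2r+2 ⟩
    (2 ℕ.+ k) ℕ.* (suc r ℕ.+ suc r)               ≡⟨ ℕP.*-distribˡ-+ (2 ℕ.+ k) (suc r) (suc r) ⟩
    (2 ℕ.+ k) ℕ.* suc r ℕ.+ (2 ℕ.+ k) ℕ.* suc r   ≤⟨ ℕP.+-mono-≤ packed packed ⟩
    N ℕ.+ N                                       ≡⟨ cong (N ℕ.+_) (ℕP.+-identityʳ N) ⟨
    2 ℕ.* N                                       ∎
    where
    open ≤-Reasoning
    r : ℕ
    r = ⌊ n /2⌋
    1+n≤2r+2 : suc n ℕ.≤ suc r ℕ.+ suc r
    1+n≤2r+2 = s≤s (≤-trans (n≤1+⌊n/2⌋+⌊n/2⌋ n) (≤-reflexive (sym (+-suc r r))))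
    packed : (2 ℕ.+ k) ℕ.* suc r ℕ.≤ N
    packed = separated-packing dist e λ i j i≢j m w →
      ≤-trans (s≤s (⌊n/2⌋+⌊n/2⌋≤n n)) (sep i j i≢j m w)

  separated-capacity : AllDistances → (λ' : ℚ) .{{_ : Positive λ'}} →
                       ∀ k (e : Fin k → Fin N) → Separated e (λ m → λ' ≤ ℕtoℚ m) →
                       ℕtoℚ k ≤ bound A λ'
  separated-capacity _ λ' 0 _ _ =
    ℚP.≤-trans (ℕtoℚ-mono-≤ {n = 1} z≤n) (ℚP.p≤p⊔q 1ℚ ((ℕtoℚ (2 ℕ.* N) ÷ λ') {{pos⇒nonZero λ'}}))
  separated-capacity _ λ' 1 _ _ = ℚP.p≤p⊔q 1ℚ ((ℕtoℚ (2 ℕ.* N) ÷ λ') {{pos⇒nonZero λ'}})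
  separated-capacity dist λ' (suc (suc k)) e sep =
    ℚP.≤-trans (*≤⇒≤÷ λ' kλ≤2N) (ℚP.p≤q⊔p 1ℚ _)
    where
    ceiling : Σ[ d ∈ ℕ ] λ' ≤ ℕtoℚ d × (∀ m → λ' ≤ ℕtoℚ m → d ℕ.≤ m)
    ceiling with d₀ , w₀ , _ ← dist (e zero) (e (suc zero)) =
      leastℕ≥ λ' d₀ (sep zero (suc zero) (λ ()) d₀ w₀)
    d : ℕ
    d = proj₁ ceiling
    kλ≤2N : ℕtoℚ (2 ℕ.+ k) ℚ.* λ' ≤ ℕtoℚ (2 ℕ.* N)
    kλ≤2N = begin
      ℕtoℚ (2 ℕ.+ k) ℚ.* λ'      ≤⟨ ℚP.*-monoˡ-≤-nonNeg (ℕtoℚ (2 ℕ.+ k)) {{ℕtoℚ-nonNeg (2 ℕ.+ k)}}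
                                      (proj₁ (proj₂ ceiling)) ⟩
      ℕtoℚ (2 ℕ.+ k) ℚ.* ℕtoℚ d  ≡⟨ ℕtoℚ-homo-* (2 ℕ.+ k) d ⟨
      ℕtoℚ ((2 ℕ.+ k) ℕ.* d)     ≤⟨ ℕtoℚ-mono-≤ (separated-bound dist {k} {d} e λ i j i≢j m w →
                                      proj₂ (proj₂ ceiling) m (sep i j i≢j m w)) ⟩
      ℕtoℚ (2 ℕ.* N)             ∎
      where open ℚP.≤-Reasoning

  admissible⇒separated : AllDistances → ∀ {λ' B} → Admissible A λ' B →
                         Separated (elements B) (λ m → λ' ≤ ℕtoℚ m)
  admissible⇒separated dist {B = B} adm i j i≢j m w = ℚP.≤-trans
    (adm _ _ (elements-∈ B i) (elements-∈ B j) (i≢j ∘ elements-injective B) _ (proj₂ (dist _ _)))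
    (ℕtoℚ-mono-≤ (proj₂ (proj₂ (dist _ _)) m w))

lemma16 : (N : ℕ) (A : SimpleGraph N) → Connected A →
          (λ' : ℚ) .{{_ : Positive λ'}} →
          (B : Subset N) → Admissible A λ' B →
          ℕtoℚ ∣ B ∣ ≤ bound A λ'
lemma16 N A c λ' B adm =
  decidable-stable (ℕtoℚ ∣ B ∣ ℚP.≤? bound A λ') λ ≰ →
    connected⇒¬¬allDistances A c λ dist →
      ≰ (separated-capacity A dist λ' ∣ B ∣ (elements B) (admissible⇒separated A dist adm))
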